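{- Let $H=(V,E)$ be an $(\alpha,\beta)$-colorable hypergraph and let $V_1\subseteq V$ be a maximal independent set of $H$. Let $V'=V\setminus V_1$ and let $H'$ be the subhypergraph of $H$ induced by $V'$. Then $H'$ is $(\alpha-1,\beta)$-colorable.
   Context: For a hypergraph $H=(V,E)$: the degree of a vertex is the number of edges containing it; a $\beta$-core is a maximal subhypergraph in which every vertex has degree at least $\beta$; for $U\subseteq V$, "$U$ has a $\beta$-core" means the subhypergraph induced by $U$ has a nonempty $\beta$-core. A set is independent if it contains no edge. A sequence $V_1,\dots,V_\alpha$ of (possibly empty) sets is a maximally independent sequence of length $\alpha$ if for each $j$, $V_j$ is a maximal independent set in the subhypergraph induced by $V\setminus\bigcup_{i<j}V_i$. $H$ is $(\alpha,\beta)$-colorable if there does not exist a maximally independent sequence of length $\alpha$ such that $V\setminus\bigcup_{i\leq\alpha}V_i$ has a $\beta$-core. -}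

module Defs where

open import Data.Nat using (ℕ; _≥_)
open import Data.Fin using (Fin)
open import Data.Fin.Subset using (Subset; _∈_; _⊆_; _─_; ⊤; Nonempty)
open import Data.Fin.Subset.Properties using (_⊆?_; _∈?_)
open import Data.List using (List; filter; length)
open import Data.List.Relation.Unary.Any using (Any)
open import Data.List.Relation.Unary.Unique.Propositional using (Unique)
open import Data.Vec using (Vec; []; _∷_)
open import Data.Product using (_×_; Σ; ∃)
open import Data.Unit using () renaming (⊤ to Unit)
open import Relation.Nullary using (¬_)
open import Relation.Nullary.Decidable using (_×-dec_)

record Hypergraph : Set where
  field
    n      : ℕ
    edges  : List (Subset n)
    unique : Unique edges
open Hypergraph public

-- Degree of vertex v in the subhypergraph of H induced by W
-- (edges of H[W] are the edges of H contained in W).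
degreeIn : (H : Hypergraph) → Subset (n H) → Fin (n H) → ℕ
degreeIn H W v = length (filter (λ e → (e ⊆? W) ×-dec (v ∈? e)) (edges H))

-- W contains no edge of H (equivalently, of any induced subhypergraph containing W).
Independent : (H : Hypergraph) → Subset (n H) → Set
Independent H W = ¬ Any (λ e → e ⊆ W) (edges H)

MaxIndepIn : (H : Hypergraph) → Subset (n H) → Subset (n H) → Set
MaxIndepIn H U W =
  W ⊆ U × Independent H W ×
  (∀ (W' : Subset (n H)) → W ⊆ W' → W' ⊆ U → Independent H W' → W' ⊆ W)

-- The subhypergraph H[U] has a nonempty β-core: since the β-core is the
-- maximal (induced) subhypergraph with minimum degree ≥ β (the union of all
-- such subhypergraphs), it is nonempty iff some nonempty W ⊆ U induces a
-- subhypergraph in which every vertex has degree ≥ β.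
HasCore : (H : Hypergraph) → ℕ → Subset (n H) → Set
HasCore H β U =
  Σ (Subset (n H)) λ W → W ⊆ U × Nonempty W × (∀ v → v ∈ W → degreeIn H W v ≥ β)

MaxIndepSeq : (H : Hypergraph) → Subset (n H) → ∀ {α} → Vec (Subset (n H)) α → Set
MaxIndepSeq H U []       = Unit
MaxIndepSeq H U (W ∷ Ws) = MaxIndepIn H U W × MaxIndepSeq H (U ─ W) Ws

remaining : ∀ {n α} → Subset n → Vec (Subset n) α → Subset n
remaining U []       = U
remaining U (W ∷ Ws) = remaining (U ─ W) Ws

ColorableOn : (H : Hypergraph) → Subset (n H) → ℕ → ℕ → Set
ColorableOn H U α β =
  ¬ Σ (Vec (Subset (n H)) α) λ Vs → MaxIndepSeq H U Vs × HasCore H β (remaining U Vs)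

Colorable : Hypergraph → ℕ → ℕ → Set
Colorable H α β = ColorableOn H ⊤ α β

module Submission where

open import Defs
open import Data.Nat using (ℕ; _∸_; zero; suc)
open import Data.Fin.Subset using (Subset; ⊤; _─_; _⊆_)
open import Data.Fin.Subset.Properties using (⊆⊤; ⊆-trans)
open import Data.Vec using ([]; _∷_)
open import Data.Product using (_,_)

HasCore-mono : ∀ (H : Hypergraph) β {U U' : Subset (n H)} →
               U ⊆ U' → HasCore H β U → HasCore H β U'
HasCore-mono H β U⊆U' (W , W⊆U , nonempty , degrees) =
  W , ⊆-trans W⊆U U⊆U' , nonempty , degrees

-- A bad sequence of H[U ─ W] is extended by W to a bad sequence of H[U].
ColorableOn-remove : ∀ (H : Hypergraph) {U W : Subset (n H)} α β →
                     ColorableOn H U (suc α) β → MaxIndepIn H U W →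
                     ColorableOn H (U ─ W) α β
ColorableOn-remove H α β colorable maxIndep (Vs , seq , core) =
  colorable (_ ∷ Vs , (maxIndep , seq) , core)

ColorableOn-zero-shrink : ∀ (H : Hypergraph) β {U U' : Subset (n H)} →
                          U ⊆ U' → ColorableOn H U' 0 β → ColorableOn H U 0 β
ColorableOn-zero-shrink H β U⊆U' colorable ([] , _ , core) =
  colorable ([] , _ , HasCore-mono H β U⊆U' core)

lemma1 : (H : Hypergraph) (α β : ℕ) (V₁ : Subset (n H)) →
         Colorable H α β → MaxIndepIn H ⊤ V₁ →
         ColorableOn H (⊤ ─ V₁) (α ∸ 1) β
-- For α = 0 we have α ∸ 1 = 0, so no independent set is removed on either side.
lemma1 H zero    β V₁ colorable _        = ColorableOn-zero-shrink H β ⊆⊤ colorable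
lemma1 H (suc α) β V₁ colorable maxIndep = ColorableOn-remove H α β colorable maxIndep
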